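{- The Kleisli category $\mathcal{C}^?$ of a forward-liberalizable symmetric monoidal category $\mathcal{C} = (\mathcal{C}, ⅋, \bot, ?)$ with weak finite products $(1, \&)$ has finite coproducts given by the finite coproducts $(0, \oplus)$ in $\mathcal{C}$, and weak finite products given by $(1, ?(\_) \,\&\, ?(\_))$ in $\mathcal{C}$.
   Context: A symmetric monoidal category $\mathcal{C} = (\mathcal{C}, ⅋, \bot)$ (with tensor written $⅋$, "par", and unit $\bot$) is forward-liberalizable (FwL) if it has finite coproducts $(0, \oplus)$ and is equipped with a monad $? = (?, \eta, \mu)$ ("why not") on $\mathcal{C}$ such that the canonical adjunction between $\mathcal{C}$ and the Kleisli category $\mathcal{C}^?$ is monoidal, together with isomorphisms $?0 \cong \bot$ and $?(A \oplus B) \cong ?A ⅋ ?B$ natural in $A, B$. -}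

module Defs where

open import Level using (Level; _⊔_) renaming (suc to lsuc)
open import Relation.Binary using (IsEquivalence; Setoid)

record Category (o ℓ e : Level) : Set (lsuc (o ⊔ ℓ ⊔ e)) where
  infix  4 _≈_ _⇒_
  infixr 9 _∘_
  field
    Obj       : Set o
    _⇒_       : Obj → Obj → Set ℓ
    _≈_       : ∀ {A B} → (A ⇒ B) → (A ⇒ B) → Set e
    id        : ∀ {A} → A ⇒ A
    _∘_       : ∀ {A B C} → B ⇒ C → A ⇒ B → A ⇒ C
    equiv     : ∀ {A B} → IsEquivalence (_≈_ {A} {B})
    ∘-resp-≈  : ∀ {A B C} {f h : B ⇒ C} {g i : A ⇒ B} →
                f ≈ h → g ≈ i → f ∘ g ≈ h ∘ i
    assoc     : ∀ {A B C D} {f : A ⇒ B} {g : B ⇒ C} {h : C ⇒ D} →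
                (h ∘ g) ∘ f ≈ h ∘ (g ∘ f)
    identityˡ : ∀ {A B} {f : A ⇒ B} → id ∘ f ≈ f
    identityʳ : ∀ {A B} {f : A ⇒ B} → f ∘ id ≈ f

  module Eq {A B : Obj} = IsEquivalence (equiv {A} {B})

  hom-setoid : Obj → Obj → Setoid ℓ e
  hom-setoid A B = record { Carrier = A ⇒ B ; _≈_ = _≈_ ; isEquivalence = equiv }

  infixr 5 _○_
  _○_ : ∀ {A B} {f g h : A ⇒ B} → f ≈ g → g ≈ h → f ≈ h
  p ○ q = Eq.trans p q

  infixr 6 _⟩∘⟨_
  _⟩∘⟨_ : ∀ {A B C} {f h : B ⇒ C} {g i : A ⇒ B} →
          f ≈ h → g ≈ i → f ∘ g ≈ h ∘ i
  _⟩∘⟨_ = ∘-resp-≈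

  refl⟩∘⟨_ : ∀ {A B C} {f : B ⇒ C} {g i : A ⇒ B} → g ≈ i → f ∘ g ≈ f ∘ i
  refl⟩∘⟨ p = ∘-resp-≈ Eq.refl p

  _⟩∘⟨refl : ∀ {A B C} {f h : B ⇒ C} {g : A ⇒ B} → f ≈ h → f ∘ g ≈ h ∘ g
  p ⟩∘⟨refl = ∘-resp-≈ p Eq.refl

record _≅_ {o ℓ e} {C : Category o ℓ e} (A B : Category.Obj C) : Set (ℓ ⊔ e) where
  open Category C
  field
    from : A ⇒ B
    to   : B ⇒ A
    isoˡ : to ∘ from ≈ id
    isoʳ : from ∘ to ≈ id

record Functor {o ℓ e o′ ℓ′ e′} (C : Category o ℓ e) (D : Category o′ ℓ′ e′)
       : Set (o ⊔ ℓ ⊔ e ⊔ o′ ⊔ ℓ′ ⊔ e′) where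
  private
    module C = Category C
    module D = Category D
  field
    F₀           : C.Obj → D.Obj
    F₁           : ∀ {A B} → A C.⇒ B → F₀ A D.⇒ F₀ B
    identity     : ∀ {A} → F₁ (C.id {A}) D.≈ D.id
    homomorphism : ∀ {X Y Z} {f : X C.⇒ Y} {g : Y C.⇒ Z} →
                   F₁ (g C.∘ f) D.≈ F₁ g D.∘ F₁ f
    F-resp-≈     : ∀ {A B} {f g : A C.⇒ B} → f C.≈ g → F₁ f D.≈ F₁ g

record Monoidal {o ℓ e} (C : Category o ℓ e) : Set (o ⊔ ℓ ⊔ e) where
  open Category C
  infixr 10 _⊗₀_ _⊗₁_
  field
    unit  : Obj
    _⊗₀_  : Obj → Obj → Obj
    _⊗₁_  : ∀ {A B C D} → A ⇒ B → C ⇒ D → (A ⊗₀ C) ⇒ (B ⊗₀ D)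
    ⊗-resp-≈ : ∀ {A B C D} {f f′ : A ⇒ B} {g g′ : C ⇒ D} →
               f ≈ f′ → g ≈ g′ → f ⊗₁ g ≈ f′ ⊗₁ g′
    ⊗-identity : ∀ {A B} → id {A} ⊗₁ id {B} ≈ id
    ⊗-homomorphism : ∀ {A B C D E F} {f : A ⇒ B} {g : B ⇒ C} {h : D ⇒ E} {k : E ⇒ F} →
                     (g ∘ f) ⊗₁ (k ∘ h) ≈ (g ⊗₁ k) ∘ (f ⊗₁ h)
    α⇒ : ∀ {X Y Z} → (X ⊗₀ Y) ⊗₀ Z ⇒ X ⊗₀ (Y ⊗₀ Z)
    α⇐ : ∀ {X Y Z} → X ⊗₀ (Y ⊗₀ Z) ⇒ (X ⊗₀ Y) ⊗₀ Z
    α-isoˡ : ∀ {X Y Z} → α⇐ ∘ α⇒ {X} {Y} {Z} ≈ id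
    α-isoʳ : ∀ {X Y Z} → α⇒ ∘ α⇐ {X} {Y} {Z} ≈ id
    α-natural : ∀ {X X′ Y Y′ Z Z′} {f : X ⇒ X′} {g : Y ⇒ Y′} {h : Z ⇒ Z′} →
                α⇒ ∘ ((f ⊗₁ g) ⊗₁ h) ≈ (f ⊗₁ (g ⊗₁ h)) ∘ α⇒
    λ⇒ : ∀ {X} → unit ⊗₀ X ⇒ X
    λ⇐ : ∀ {X} → X ⇒ unit ⊗₀ X
    λ-isoˡ : ∀ {X} → λ⇐ ∘ λ⇒ {X} ≈ id
    λ-isoʳ : ∀ {X} → λ⇒ ∘ λ⇐ {X} ≈ id
    λ-natural : ∀ {X Y} {f : X ⇒ Y} → λ⇒ ∘ (id ⊗₁ f) ≈ f ∘ λ⇒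
    ρ⇒ : ∀ {X} → X ⊗₀ unit ⇒ X
    ρ⇐ : ∀ {X} → X ⇒ X ⊗₀ unit
    ρ-isoˡ : ∀ {X} → ρ⇐ ∘ ρ⇒ {X} ≈ id
    ρ-isoʳ : ∀ {X} → ρ⇒ ∘ ρ⇐ {X} ≈ id
    ρ-natural : ∀ {X Y} {f : X ⇒ Y} → ρ⇒ ∘ (f ⊗₁ id) ≈ f ∘ ρ⇒
    pentagon : ∀ {W X Y Z} →
               α⇒ {W} {X} {Y ⊗₀ Z} ∘ α⇒ {W ⊗₀ X} {Y} {Z}
               ≈ (id ⊗₁ α⇒) ∘ (α⇒ ∘ (α⇒ ⊗₁ id))
    triangle : ∀ {X Y} → (id {X} ⊗₁ λ⇒ {Y}) ∘ α⇒ ≈ ρ⇒ ⊗₁ id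

record Symmetric {o ℓ e} {C : Category o ℓ e} (M : Monoidal C) : Set (o ⊔ ℓ ⊔ e) where
  open Category C
  open Monoidal M
  field
    σ : ∀ {X Y} → X ⊗₀ Y ⇒ Y ⊗₀ X
    σ-natural : ∀ {X X′ Y Y′} {f : X ⇒ X′} {g : Y ⇒ Y′} →
                σ ∘ (f ⊗₁ g) ≈ (g ⊗₁ f) ∘ σ
    commutative : ∀ {X Y} → σ {Y} {X} ∘ σ {X} {Y} ≈ id
    hexagon : ∀ {X Y Z} →
              α⇒ {Y} {Z} {X} ∘ (σ {X} {Y ⊗₀ Z} ∘ α⇒)
              ≈ (id ⊗₁ σ) ∘ (α⇒ ∘ (σ ⊗₁ id))

record SymmetricMonoidal {o ℓ e} (C : Category o ℓ e) : Set (o ⊔ ℓ ⊔ e) where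
  field
    monoidal  : Monoidal C
    symmetric : Symmetric monoidal

record Monad {o ℓ e} (C : Category o ℓ e) : Set (o ⊔ ℓ ⊔ e) where
  open Category C
  field
    F : Functor C C
  open Functor F public
  field
    η : ∀ {X} → X ⇒ F₀ X
    μ : ∀ {X} → F₀ (F₀ X) ⇒ F₀ X
    η-natural : ∀ {X Y} {f : X ⇒ Y} → η ∘ f ≈ F₁ f ∘ η
    μ-natural : ∀ {X Y} {f : X ⇒ Y} → μ ∘ F₁ (F₁ f) ≈ F₁ f ∘ μ
    m-assoc     : ∀ {X} → μ {X} ∘ F₁ μ ≈ μ ∘ μ
    m-identityˡ : ∀ {X} → μ {X} ∘ F₁ η ≈ id
    m-identityʳ : ∀ {X} → μ {X} ∘ η ≈ id

Kleisli : ∀ {o ℓ e} {C : Category o ℓ e} → Monad C → Category o ℓ e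
Kleisli {C = C} M = record
  { Obj = Obj
  ; _⇒_ = λ A B → A ⇒ F₀ B
  ; _≈_ = _≈_
  ; id = η
  ; _∘_ = λ g f → μ ∘ (F₁ g ∘ f)
  ; equiv = equiv
  ; ∘-resp-≈ = λ p q → refl⟩∘⟨ (F-resp-≈ p ⟩∘⟨ q)
  ; assoc = kassoc
  ; identityˡ = (Eq.sym assoc) ○ (m-identityˡ ⟩∘⟨refl) ○ identityˡ
  ; identityʳ = (refl⟩∘⟨ Eq.sym η-natural) ○ Eq.sym assoc ○ (m-identityʳ ⟩∘⟨refl) ○ identityˡ
  }
  where
  open Category C
  open Monad M
  kassoc : ∀ {A B C′ D} {f : A ⇒ F₀ B} {g : B ⇒ F₀ C′} {h : C′ ⇒ F₀ D} →
           μ ∘ (F₁ (μ ∘ (F₁ h ∘ g)) ∘ f) ≈ μ ∘ (F₁ h ∘ (μ ∘ (F₁ g ∘ f)))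
  kassoc =
       (refl⟩∘⟨ ((homomorphism ○ (refl⟩∘⟨ homomorphism)) ⟩∘⟨refl))
     ○ (refl⟩∘⟨ assoc)
     ○ Eq.sym assoc
     ○ (m-assoc ⟩∘⟨refl)
     ○ assoc
     ○ (refl⟩∘⟨ refl⟩∘⟨ assoc)
     ○ (refl⟩∘⟨ Eq.sym assoc)
     ○ (refl⟩∘⟨ (μ-natural ⟩∘⟨refl))
     ○ (refl⟩∘⟨ assoc)

record Adjunction {o ℓ e o′ ℓ′ e′} {C : Category o ℓ e} {D : Category o′ ℓ′ e′}
       (L : Functor C D) (R : Functor D C) : Set (o ⊔ ℓ ⊔ e ⊔ o′ ⊔ ℓ′ ⊔ e′) where
  private
    module C = Category C
    module D = Category D
    module L = Functor L
    module R = Functor R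
  field
    unit   : ∀ X → X C.⇒ R.F₀ (L.F₀ X)
    counit : ∀ Y → L.F₀ (R.F₀ Y) D.⇒ Y
    unit-natural   : ∀ {X X′} (f : X C.⇒ X′) →
                     unit X′ C.∘ f C.≈ R.F₁ (L.F₁ f) C.∘ unit X
    counit-natural : ∀ {Y Y′} (g : Y D.⇒ Y′) →
                     counit Y′ D.∘ L.F₁ (R.F₁ g) D.≈ g D.∘ counit Y
    zig : ∀ {X} → counit (L.F₀ X) D.∘ L.F₁ (unit X) D.≈ D.id
    zag : ∀ {Y} → R.F₁ (counit Y) C.∘ unit (R.F₀ Y) C.≈ C.id

record LaxMonoidal {o ℓ e o′ ℓ′ e′} {C : Category o ℓ e} {D : Category o′ ℓ′ e′}
       (MC : Monoidal C) (MD : Monoidal D) (F : Functor C D)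
       : Set (o ⊔ ℓ ⊔ e ⊔ o′ ⊔ ℓ′ ⊔ e′) where
  private
    module C = Category C
    module D = Category D
    module MC = Monoidal MC
    module MD = Monoidal MD
  open Functor F
  field
    φ  : ∀ {A B} → F₀ A MD.⊗₀ F₀ B D.⇒ F₀ (A MC.⊗₀ B)
    φ₀ : MD.unit D.⇒ F₀ MC.unit
    φ-natural : ∀ {A A′ B B′} {f : A C.⇒ A′} {g : B C.⇒ B′} →
                φ D.∘ (F₁ f MD.⊗₁ F₁ g) D.≈ F₁ (f MC.⊗₁ g) D.∘ φ
    associativity : ∀ {A B C′} →
                    F₁ (MC.α⇒ {A} {B} {C′}) D.∘ (φ D.∘ (φ MD.⊗₁ D.id))
                    D.≈ φ D.∘ ((D.id MD.⊗₁ φ) D.∘ MD.α⇒)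
    unitaryˡ : ∀ {A} → F₁ (MC.λ⇒ {A}) D.∘ (φ D.∘ (φ₀ MD.⊗₁ D.id)) D.≈ MD.λ⇒
    unitaryʳ : ∀ {A} → F₁ (MC.ρ⇒ {A}) D.∘ (φ D.∘ (D.id MD.⊗₁ φ₀)) D.≈ MD.ρ⇒

record MonoidalAdjunction {o ℓ e o′ ℓ′ e′} {C : Category o ℓ e} {D : Category o′ ℓ′ e′}
       (MC : Monoidal C) (MD : Monoidal D) {L : Functor C D} {R : Functor D C}
       (adj : Adjunction L R) : Set (o ⊔ ℓ ⊔ e ⊔ o′ ⊔ ℓ′ ⊔ e′) where
  private
    module C = Category C
    module D = Category D
    module MC = Monoidal MC
    module MD = Monoidal MD
    module L = Functor L
    module R = Functor R
  open Adjunction adj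
  field
    L-lax : LaxMonoidal MC MD L
    R-lax : LaxMonoidal MD MC R
  private
    module Ll = LaxMonoidal L-lax
    module Rl = LaxMonoidal R-lax
  field
    unit-monoidal  : ∀ {A B} →
                     unit (A MC.⊗₀ B)
                     C.≈ (R.F₁ Ll.φ C.∘ Rl.φ) C.∘ (unit A MC.⊗₁ unit B)
    unit-monoidal₀ : unit MC.unit C.≈ R.F₁ Ll.φ₀ C.∘ Rl.φ₀
    counit-monoidal  : ∀ {A B} →
                       counit (A MD.⊗₀ B) D.∘ (L.F₁ Rl.φ D.∘ Ll.φ)
                       D.≈ counit A MD.⊗₁ counit B
    counit-monoidal₀ : counit MD.unit D.∘ (L.F₁ Rl.φ₀ D.∘ Ll.φ₀) D.≈ D.id

module _ {o ℓ e} {C : Category o ℓ e} (M : Monad C) where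
  open Category C
  open Monad M

  KleisliFree : Functor C (Kleisli M)
  KleisliFree = record
    { F₀ = λ A → A
    ; F₁ = λ f → η ∘ f
    ; identity = identityʳ
    ; homomorphism = Eq.sym
        ( (refl⟩∘⟨ Eq.sym assoc)
        ○ (refl⟩∘⟨ (Eq.sym η-natural ⟩∘⟨refl))
        ○ (refl⟩∘⟨ assoc)
        ○ Eq.sym assoc
        ○ (m-identityʳ ⟩∘⟨refl)
        ○ identityˡ
        ○ assoc )
    ; F-resp-≈ = refl⟩∘⟨_
    }

  KleisliForget : Functor (Kleisli M) C
  KleisliForget = record
    { F₀ = F₀
    ; F₁ = λ f → μ ∘ F₁ f
    ; identity = m-identityˡ
    ; homomorphism =
          (refl⟩∘⟨ (homomorphism ○ (refl⟩∘⟨ homomorphism)))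
        ○ Eq.sym assoc
        ○ (m-assoc ⟩∘⟨refl)
        ○ assoc
        ○ (refl⟩∘⟨ Eq.sym assoc)
        ○ (refl⟩∘⟨ (μ-natural ⟩∘⟨refl))
        ○ (refl⟩∘⟨ assoc)
        ○ Eq.sym assoc
    ; F-resp-≈ = λ p → refl⟩∘⟨ F-resp-≈ p
    }

  -- unit η_A : A → T A ; counit at B is id_{T B}, viewed as a Kleisli map T B → B
  KleisliAdjunction : Adjunction KleisliFree KleisliForget
  KleisliAdjunction = record
    { unit = λ X → η
    ; counit = λ Y → id
    ; unit-natural = λ f → Eq.sym
        ( assoc
        ○ (refl⟩∘⟨ Eq.sym η-natural)
        ○ Eq.sym assoc
        ○ (m-identityʳ ⟩∘⟨refl)
        ○ identityˡ )
    ; counit-natural = λ g →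
          (refl⟩∘⟨ (identity ⟩∘⟨refl))
        ○ (refl⟩∘⟨ identityˡ)
        ○ Eq.sym assoc
        ○ (m-identityʳ ⟩∘⟨refl)
        ○ identityˡ
        ○ Eq.sym (refl⟩∘⟨ identityʳ)
    ; zig = (refl⟩∘⟨ (identity ⟩∘⟨refl))
          ○ (refl⟩∘⟨ identityˡ)
          ○ Eq.sym assoc
          ○ (m-identityʳ ⟩∘⟨refl)
          ○ identityˡ
    ; zag = ((refl⟩∘⟨ identity) ⟩∘⟨refl)
          ○ (identityʳ ⟩∘⟨refl)
          ○ m-identityʳ
    }

module _ {o ℓ e} (C : Category o ℓ e) where
  open Category C

  record IsInitial (⊥ : Obj) : Set (o ⊔ ℓ ⊔ e) where
    field
      !        : ∀ {A} → ⊥ ⇒ A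
      !-unique : ∀ {A} (f : ⊥ ⇒ A) → ! ≈ f

  record Initial : Set (o ⊔ ℓ ⊔ e) where
    field
      ⊥         : Obj
      isInitial : IsInitial ⊥
    open IsInitial isInitial public

  record IsCoproduct {A B P : Obj} (i₁ : A ⇒ P) (i₂ : B ⇒ P) : Set (o ⊔ ℓ ⊔ e) where
    field
      [_,_]    : ∀ {X} → A ⇒ X → B ⇒ X → P ⇒ X
      inject₁  : ∀ {X} {f : A ⇒ X} {g : B ⇒ X} → [ f , g ] ∘ i₁ ≈ f
      inject₂  : ∀ {X} {f : A ⇒ X} {g : B ⇒ X} → [ f , g ] ∘ i₂ ≈ g
      unique   : ∀ {X} {f : A ⇒ X} {g : B ⇒ X} {h : P ⇒ X} →
                 h ∘ i₁ ≈ f → h ∘ i₂ ≈ g → [ f , g ] ≈ h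

  record Coproduct (A B : Obj) : Set (o ⊔ ℓ ⊔ e) where
    field
      A+B : Obj
      i₁  : A ⇒ A+B
      i₂  : B ⇒ A+B
      isCoproduct : IsCoproduct i₁ i₂
    open IsCoproduct isCoproduct public

  record FiniteCoproducts : Set (o ⊔ ℓ ⊔ e) where
    field
      initial   : Initial
      coproduct : ∀ A B → Coproduct A B
    open Initial initial public using () renaming (⊥ to 𝟘)
    infixr 6 _⊕_ _⊕₁_
    _⊕_ : Obj → Obj → Obj
    A ⊕ B = Coproduct.A+B (coproduct A B)
    inj₁ : ∀ {A B} → A ⇒ A ⊕ B
    inj₁ {A} {B} = Coproduct.i₁ (coproduct A B)
    inj₂ : ∀ {A B} → B ⇒ A ⊕ B
    inj₂ {A} {B} = Coproduct.i₂ (coproduct A B)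
    _⊕₁_ : ∀ {A A′ B B′} → A ⇒ A′ → B ⇒ B′ → A ⊕ B ⇒ A′ ⊕ B′
    _⊕₁_ {A} {A′} {B} {B′} f g =
      Coproduct.[_,_] (coproduct A B) (inj₁ ∘ f) (inj₂ ∘ g)

  record IsWeakTerminal (⊤ : Obj) : Set (o ⊔ ℓ ⊔ e) where
    field
      ! : ∀ {A} → A ⇒ ⊤

  record IsWeakProduct {A B P : Obj} (π₁ : P ⇒ A) (π₂ : P ⇒ B) : Set (o ⊔ ℓ ⊔ e) where
    field
      ⟨_,_⟩    : ∀ {X} → X ⇒ A → X ⇒ B → X ⇒ P
      project₁ : ∀ {X} {f : X ⇒ A} {g : X ⇒ B} → π₁ ∘ ⟨ f , g ⟩ ≈ f
      project₂ : ∀ {X} {f : X ⇒ A} {g : X ⇒ B} → π₂ ∘ ⟨ f , g ⟩ ≈ g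

  record WeakProduct (A B : Obj) : Set (o ⊔ ℓ ⊔ e) where
    field
      A×B : Obj
      π₁  : A×B ⇒ A
      π₂  : A×B ⇒ B
      isWeakProduct : IsWeakProduct π₁ π₂
    open IsWeakProduct isWeakProduct public

  record WeakFiniteProducts : Set (o ⊔ ℓ ⊔ e) where
    field
      𝟙 : Obj
      𝟙-isWeakTerminal : IsWeakTerminal 𝟙
      weakProduct : ∀ A B → WeakProduct A B
    infixr 7 _&_
    _&_ : Obj → Obj → Obj
    A & B = WeakProduct.A×B (weakProduct A B)
    π₁ : ∀ {A B} → A & B ⇒ A
    π₁ {A} {B} = WeakProduct.π₁ (weakProduct A B)
    π₂ : ∀ {A B} → A & B ⇒ B
    π₂ {A} {B} = WeakProduct.π₂ (weakProduct A B)

-- Forward-liberalizable symmetric monoidal categories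
-- (C, ⅋, ⊥) symmetric monoidal; monad ? = (?, η, μ) written `whyNot`.

record ForwardLiberalizable {o ℓ e} (C : Category o ℓ e) (SM : SymmetricMonoidal C)
       : Set (lsuc (o ⊔ ℓ ⊔ e)) where
  open Category C
  private
    module SM = SymmetricMonoidal SM
  open Monoidal SM.monoidal using () renaming (unit to ⊥; _⊗₀_ to _⅋_; _⊗₁_ to _⅋₁_)
  field
    coproducts : FiniteCoproducts C
    whyNot     : Monad C
  open FiniteCoproducts coproducts
  open Monad whyNot using (F₀; F₁)
  field
    kleisliMonoidal : Monoidal (Kleisli whyNot)
    canonical-monoidal : MonoidalAdjunction SM.monoidal kleisliMonoidal
                           (KleisliAdjunction whyNot)
    ?0≅⊥ : _≅_ {C = C} (F₀ 𝟘) ⊥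
    ?⊕≅⅋ : ∀ A B → _≅_ {C = C} (F₀ (A ⊕ B)) (F₀ A ⅋ F₀ B)
    ?⊕≅⅋-natural : ∀ {A A′ B B′} (f : A ⇒ A′) (g : B ⇒ B′) →
                   _≅_.from (?⊕≅⅋ A′ B′) ∘ F₁ (f ⊕₁ g)
                   ≈ (F₁ f ⅋₁ F₁ g) ∘ _≅_.from (?⊕≅⅋ A B)

-- Conclusion of the theorem: in C^?,
--  * 0 is initial and A ⊕ B with injections η ∘ inj₁, η ∘ inj₂ is a coproduct
--    (finite coproducts given by (0, ⊕) of C);
--  * 1 is weakly terminal and ?A & ?B with the C-projections
--    π₁ : ?A & ?B → ?A, π₂ : ?A & ?B → ?B (i.e. Kleisli maps to A, B) is a
--    weak product (weak finite products given by (1, ?(_) & ?(_))).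

open import Data.Product using (_×_)

KleisliCoproductsAndWeakProducts :
  ∀ {o ℓ e} {C : Category o ℓ e} {SM : SymmetricMonoidal C} →
  ForwardLiberalizable C SM → WeakFiniteProducts C → Set (o ⊔ ℓ ⊔ e)
KleisliCoproductsAndWeakProducts {C = C} FwL W =
    IsInitial C? 𝟘
  × (∀ A B → IsCoproduct C? {A} {B} {A ⊕ B} (η ∘ inj₁) (η ∘ inj₂))
  × IsWeakTerminal C? 𝟙
  × (∀ A B → IsWeakProduct C? {A} {B} {F₀ A & F₀ B} π₁ π₂)
  where
  open Category C
  open ForwardLiberalizable FwL
  open FiniteCoproducts coproducts
  open WeakFiniteProducts W
  open Monad whyNot using (F₀; η)
  C? = Kleisli whyNot

{-# OPTIONS --safe #-}
module Submission where

open import Defs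
open import Data.Product using (_,_)

-- Kleisli composition with a pure map η ∘ k is ordinary precomposition with k.
-- Hence the free functor C → C^T (a left adjoint) carries the initial object
-- and coproducts of C to C^T, while a C-map X → T A is the same thing as a
-- Kleisli map X → A, so a weak product of T A and T B in C is a weak product
-- of A and B in C^T.

module KleisliProperties {o ℓ e} {C : Category o ℓ e} (M : Monad C) where
  open Category C
  open Monad M using (F₀; F₁; η; μ; η-natural; m-identityʳ)
  private
    C^T = Kleisli M
    module C^T = Category C^T

  kleisli-∘-pure : ∀ {X Y Z} {h : Y ⇒ F₀ Z} {k : X ⇒ Y} → h C^T.∘ (η ∘ k) ≈ h ∘ k
  kleisli-∘-pure {h = h} {k} = begin
    μ ∘ (F₁ h ∘ (η ∘ k)) ≈⟨ refl⟩∘⟨ Eq.sym assoc ⟩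
    μ ∘ ((F₁ h ∘ η) ∘ k) ≈⟨ refl⟩∘⟨ (Eq.sym η-natural ⟩∘⟨refl) ⟩
    μ ∘ ((η ∘ h) ∘ k)    ≈⟨ refl⟩∘⟨ assoc ⟩
    μ ∘ (η ∘ (h ∘ k))    ≈⟨ Eq.sym assoc ⟩
    (μ ∘ η) ∘ (h ∘ k)    ≈⟨ m-identityʳ ⟩∘⟨refl ⟩
    id ∘ (h ∘ k)         ≈⟨ identityˡ ⟩
    h ∘ k                ∎
    where open import Relation.Binary.Reasoning.Setoid (hom-setoid _ _)

  kleisli-isInitial : ∀ {I} → IsInitial C I → IsInitial C^T I
  kleisli-isInitial isInitial = record { ! = ! ; !-unique = !-unique }
    where open IsInitial isInitial

  kleisli-isCoproduct : ∀ {A B P} {i₁ : A ⇒ P} {i₂ : B ⇒ P} →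
                        IsCoproduct C i₁ i₂ → IsCoproduct C^T (η ∘ i₁) (η ∘ i₂)
  kleisli-isCoproduct isCoproduct = record
    { [_,_]   = [_,_]
    ; inject₁ = kleisli-∘-pure ○ inject₁
    ; inject₂ = kleisli-∘-pure ○ inject₂
    ; unique  = λ p q → unique (Eq.sym kleisli-∘-pure ○ p) (Eq.sym kleisli-∘-pure ○ q)
    }
    where open IsCoproduct isCoproduct

  kleisli-isWeakTerminal : ∀ {T} → IsWeakTerminal C T → IsWeakTerminal C^T T
  kleisli-isWeakTerminal isWeakTerminal = record { ! = η ∘ ! }
    where open IsWeakTerminal isWeakTerminal

  kleisli-isWeakProduct : ∀ {A B P} {p₁ : P ⇒ F₀ A} {p₂ : P ⇒ F₀ B} →
                          IsWeakProduct C p₁ p₂ → IsWeakProduct C^T {A} {B} p₁ p₂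
  kleisli-isWeakProduct isWeakProduct = record
    { ⟨_,_⟩    = λ f g → η ∘ ⟨ f , g ⟩
    ; project₁ = kleisli-∘-pure ○ project₁
    ; project₂ = kleisli-∘-pure ○ project₂
    }
    where open IsWeakProduct isWeakProduct

mainTheorem2 : ∀ {o ℓ e} (C : Category o ℓ e) (SM : SymmetricMonoidal C)
    (FwL : ForwardLiberalizable C SM) (W : WeakFiniteProducts C) →
    KleisliCoproductsAndWeakProducts FwL W
mainTheorem2 C SM FwL W =
    kleisli-isInitial (Initial.isInitial initial)
  , (λ A B → kleisli-isCoproduct (Coproduct.isCoproduct (coproduct A B)))
  , kleisli-isWeakTerminal 𝟙-isWeakTerminal
  , (λ A B → kleisli-isWeakProduct (WeakProduct.isWeakProduct (weakProduct (F₀ A) (F₀ B))))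
  where
  open ForwardLiberalizable FwL
  open FiniteCoproducts coproducts
  open WeakFiniteProducts W
  open Monad whyNot using (F₀)
  open KleisliProperties whyNot
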